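{- The relation algebra $52_{65}$ is representable over a finite set. That is, there exist a finite set $U$ and nonempty symmetric binary relations $R_a, R_b, R_c \subseteq U\times U$ such that $\{\,\{(x,x):x\in U\},\,R_a,\,R_b,\,R_c\,\}$ is a partition of $U\times U$ and, for all $i,j,k\in\{a,b,c\}$ and all $(x,y)\in R_i$: there exists $z\in U$ with $(x,z)\in R_j$ and $(z,y)\in R_k$ if and only if $ijk$ is a cycle of $52_{65}$.
   Context: $52_{65}$ is the finite integral symmetric relation algebra (numbered as in Maddux's book) with atoms $1'$ (identity), $a$, $b$, $c$, all symmetric. Its diversity cycles (triples $ijk$ of diversity atoms, considered up to permutation of the three entries) are $aaa$, $bbb$, $acc$, $aab$, $aac$, $bcc$, $abc$; the triples $ccc$, $abb$, $cbb$ (and their permutations) are not cycles. A representation over a set $U$ sends $1'$ to the identity relation on $U$ and $a,b,c$ to relations $R_a,R_b,R_c$ as described in the claim. -}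

module Defs where

open import Data.Nat using (ℕ)
open import Data.Fin using (Fin)
open import Data.Product using (Σ; ∃; _×_; _,_)
open import Data.Sum using (_⊎_)
open import Data.Empty using (⊥)
open import Data.Unit using (⊤)
open import Relation.Nullary using (¬_)
open import Relation.Binary.PropositionalEquality using (_≡_)
open import Function.Bundles using (_⇔_)

data Atom : Set where
  a b c : Atom

IsCycle : Atom → Atom → Atom → Set
IsCycle a a a = ⊤
IsCycle b b b = ⊤
IsCycle c c c = ⊥
IsCycle a a b = ⊤
IsCycle a b a = ⊤
IsCycle b a a = ⊤
IsCycle a a c = ⊤
IsCycle a c a = ⊤
IsCycle c a a = ⊤
IsCycle a b b = ⊥
IsCycle b a b = ⊥
IsCycle b b a = ⊥
IsCycle a c c = ⊤
IsCycle c a c = ⊤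
IsCycle c c a = ⊤
IsCycle b b c = ⊥
IsCycle b c b = ⊥
IsCycle c b b = ⊥
IsCycle b c c = ⊤
IsCycle c b c = ⊤
IsCycle c c b = ⊤
IsCycle a b c = ⊤
IsCycle a c b = ⊤
IsCycle b a c = ⊤
IsCycle b c a = ⊤
IsCycle c a b = ⊤
IsCycle c b a = ⊤

ExactlyOne4 : Set → Set → Set → Set → Set
ExactlyOne4 P Q R S =
  (P ⊎ Q ⊎ R ⊎ S) ×
  (¬ (P × Q)) × (¬ (P × R)) × (¬ (P × S)) ×
  (¬ (Q × R)) × (¬ (Q × S)) × (¬ (R × S))

IsRepresentation : (n : ℕ) → (Atom → Fin n → Fin n → Set) → Set
IsRepresentation n R =
  ((i : Atom) → Σ (Fin n) λ x → Σ (Fin n) λ y → R i x y) ×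
  ((i : Atom) → (x y : Fin n) → R i x y → R i y x) ×
  ((x y : Fin n) → ExactlyOne4 (x ≡ y) (R a x y) (R b x y) (R c x y)) ×
  ((i j k : Atom) → (x y : Fin n) → R i x y →
     ((Σ (Fin n) λ z → R j x z × R k z y) ⇔ IsCycle i j k))

FinitelyRepresentable : Set₁
FinitelyRepresentable =
  Σ ℕ λ n → Σ (Atom → Fin n → Fin n → Set) λ R → IsRepresentation n R

module Submission where

-- The representation is of Cayley type: for a group G and a colouring
-- χ : G → Maybe Atom, put R i x y  :⇔  χ (x⁻¹ ∙ y) ≡ just i.  The
-- "Cayley lemma" (`cayleyRepresentation`) shows that this is a representation
-- as soon as χ satisfies four conditions on single group elements: only the
-- identity is uncoloured, χ is invariant under inversion, every atom is used,
-- and for each coloured g the pairs (j , k) with g = h ∙ (h⁻¹ ∙ g),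
-- χ h ≡ just j, χ (h⁻¹ ∙ g) ≡ just k, are exactly those for which
-- (χ g , j , k) is a cycle.  The translations z ↦ x⁻¹ ∙ z carry the
-- conditions on pairs (x , y) to conditions on the single element x⁻¹ ∙ y.

open import Defs
open import Data.Nat using (ℕ; NonZero; _∸_; >-nonZero⁻¹)
import Data.Nat as ℕ
open import Data.Nat.DivMod using (_%_; _mod_; %-distribˡ-+; m%n%n≡m%n; m<n⇒m%n≡m; n%n≡0)
open import Data.Nat.Properties using (+-assoc; +-comm; m∸n+n≡m; <⇒≤)
open import Data.Fin using (Fin; zero; suc; toℕ; _≟_)
open import Data.Fin.Properties using (all?; any?; toℕ-injective; toℕ-fromℕ<; toℕ<n)
open import Data.Vec using (Vec; []; _∷_; lookup)
open import Data.Maybe using (Maybe; just; nothing)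
import Data.Maybe.Properties as Maybe
open import Data.Product using (Σ; _×_; _,_)
open import Data.Sum using (_⊎_; inj₁; inj₂)
open import Data.Unit using (tt)
open import Relation.Nullary using (Dec; yes; no; ¬_)
open import Relation.Nullary.Decidable using (_×-dec_; _→-dec_; map′; toWitness)
open import Relation.Binary.Definitions using (DecidableEquality)
open import Relation.Binary.PropositionalEquality
  using (_≡_; refl; sym; trans; cong; cong₂; isEquivalence; module ≡-Reasoning)
open import Level using (0ℓ)
open import Algebra.Bundles using (Group)
open import Algebra.Structures using (IsGroup)
import Algebra.Properties.Group as GroupProperties
open import Function.Bundles using (_⇔_; mk⇔; Equivalence)

_⇔-dec_ : ∀ {A B : Set} → Dec A → Dec B → Dec (A ⇔ B)
A? ⇔-dec B? =
  map′ (λ (to , from) → mk⇔ to from)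
       (λ e → Equivalence.to e , Equivalence.from e)
       ((A? →-dec B?) ×-dec (B? →-dec A?))

allAtoms? : ∀ {P : Atom → Set} → ((i : Atom) → Dec (P i)) → Dec ((i : Atom) → P i)
allAtoms? {P} P? =
  map′ (λ (pa , pb , pc) → every pa pb pc) (λ p → p a , p b , p c)
       (P? a ×-dec P? b ×-dec P? c)
  where
  every : P a → P b → P c → (i : Atom) → P i
  every pa _  _  a = pa
  every _  pb _  b = pb
  every _  _  pc c = pc

_≟ᴬ_ : DecidableEquality Atom
a ≟ᴬ a = yes refl
b ≟ᴬ b = yes refl
c ≟ᴬ c = yes refl
a ≟ᴬ b = no λ ()
a ≟ᴬ c = no λ ()
b ≟ᴬ a = no λ ()
b ≟ᴬ c = no λ ()
c ≟ᴬ a = no λ ()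
c ≟ᴬ b = no λ ()

isCycle? : (i j k : Atom) → Dec (IsCycle i j k)
isCycle? a a a = yes tt
isCycle? a a b = yes tt
isCycle? a a c = yes tt
isCycle? a b a = yes tt
isCycle? a b b = no λ ()
isCycle? a b c = yes tt
isCycle? a c a = yes tt
isCycle? a c b = yes tt
isCycle? a c c = yes tt
isCycle? b a a = yes tt
isCycle? b a b = no λ ()
isCycle? b a c = yes tt
isCycle? b b a = no λ ()
isCycle? b b b = yes tt
isCycle? b b c = no λ ()
isCycle? b c a = yes tt
isCycle? b c b = no λ ()
isCycle? b c c = yes tt
isCycle? c a a = yes tt
isCycle? c a b = yes tt
isCycle? c a c = yes tt
isCycle? c b a = yes tt
isCycle? c b b = no λ ()
isCycle? c b c = yes tt
isCycle? c c a = yes tt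
isCycle? c c b = yes tt
isCycle? c c c = no λ ()

module Cyclic (n : ℕ) .{{_ : NonZero n}} where

  infixl 6 _+_
  _+_ : Fin n → Fin n → Fin n
  x + y = (toℕ x ℕ.+ toℕ y) mod n

  -_ : Fin n → Fin n
  - x = (n ∸ toℕ x) mod n

  0ℤ : Fin n
  0ℤ = 0 mod n

  %-absorbˡ : ∀ p q → (p % n ℕ.+ q) % n ≡ (p ℕ.+ q) % n
  %-absorbˡ p q = begin
    (p % n ℕ.+ q) % n             ≡⟨ %-distribˡ-+ (p % n) q n ⟩
    (p % n % n ℕ.+ q % n) % n     ≡⟨ cong (λ r → (r ℕ.+ q % n) % n) (m%n%n≡m%n p n) ⟩
    (p % n ℕ.+ q % n) % n         ≡⟨ %-distribˡ-+ p q n ⟨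
    (p ℕ.+ q) % n                 ∎
    where open ≡-Reasoning

  %-absorbʳ : ∀ p q → (p ℕ.+ q % n) % n ≡ (p ℕ.+ q) % n
  %-absorbʳ p q = begin
    (p ℕ.+ q % n) % n  ≡⟨ cong (_% n) (+-comm p (q % n)) ⟩
    (q % n ℕ.+ p) % n  ≡⟨ %-absorbˡ q p ⟩
    (q ℕ.+ p) % n      ≡⟨ cong (_% n) (+-comm q p) ⟩
    (p ℕ.+ q) % n      ∎
    where open ≡-Reasoning

  toℕ-mod : ∀ p → toℕ (p mod n) ≡ p % n
  toℕ-mod p = toℕ-fromℕ< _

  toℕ-0ℤ : toℕ 0ℤ ≡ 0
  toℕ-0ℤ = trans (toℕ-mod 0) (m<n⇒m%n≡m (>-nonZero⁻¹ n))

  +-assoc-ℤ : ∀ x y z → (x + y) + z ≡ x + (y + z)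
  +-assoc-ℤ x y z = toℕ-injective (begin
    toℕ ((x + y) + z)                          ≡⟨ toℕ-mod _ ⟩
    (toℕ (x + y) ℕ.+ toℕ z) % n                ≡⟨ cong (λ r → (r ℕ.+ toℕ z) % n) (toℕ-mod _) ⟩
    ((toℕ x ℕ.+ toℕ y) % n ℕ.+ toℕ z) % n      ≡⟨ %-absorbˡ _ (toℕ z) ⟩
    (toℕ x ℕ.+ toℕ y ℕ.+ toℕ z) % n            ≡⟨ cong (_% n) (+-assoc (toℕ x) (toℕ y) (toℕ z)) ⟩
    (toℕ x ℕ.+ (toℕ y ℕ.+ toℕ z)) % n          ≡⟨ %-absorbʳ (toℕ x) _ ⟨
    (toℕ x ℕ.+ (toℕ y ℕ.+ toℕ z) % n) % n      ≡⟨ cong (λ r → (toℕ x ℕ.+ r) % n) (toℕ-mod _) ⟨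
    (toℕ x ℕ.+ toℕ (y + z)) % n                ≡⟨ toℕ-mod _ ⟨
    toℕ (x + (y + z))                          ∎)
    where open ≡-Reasoning

  +-comm-ℤ : ∀ x y → x + y ≡ y + x
  +-comm-ℤ x y = cong (_mod n) (+-comm (toℕ x) (toℕ y))

  +-identityˡ-ℤ : ∀ x → 0ℤ + x ≡ x
  +-identityˡ-ℤ x = toℕ-injective (begin
    toℕ (0ℤ + x)                ≡⟨ toℕ-mod _ ⟩
    (toℕ 0ℤ ℕ.+ toℕ x) % n      ≡⟨ cong (λ r → (r ℕ.+ toℕ x) % n) toℕ-0ℤ ⟩
    toℕ x % n                   ≡⟨ m<n⇒m%n≡m (toℕ<n x) ⟩
    toℕ x                       ∎)
    where open ≡-Reasoning

  -‿inverseˡ-ℤ : ∀ x → (- x) + x ≡ 0ℤ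
  -‿inverseˡ-ℤ x = toℕ-injective (begin
    toℕ ((- x) + x)                     ≡⟨ toℕ-mod _ ⟩
    (toℕ (- x) ℕ.+ toℕ x) % n           ≡⟨ cong (λ r → (r ℕ.+ toℕ x) % n) (toℕ-mod _) ⟩
    ((n ∸ toℕ x) % n ℕ.+ toℕ x) % n     ≡⟨ %-absorbˡ (n ∸ toℕ x) (toℕ x) ⟩
    (n ∸ toℕ x ℕ.+ toℕ x) % n           ≡⟨ cong (_% n) (m∸n+n≡m (<⇒≤ (toℕ<n x))) ⟩
    n % n                               ≡⟨ n%n≡0 n ⟩
    0                                   ≡⟨ toℕ-0ℤ ⟨
    toℕ 0ℤ                              ∎)
    where open ≡-Reasoning

  isGroup : IsGroup _≡_ _+_ 0ℤ -_
  isGroup = record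
    { isMonoid = record
      { isSemigroup = record
        { isMagma = record { isEquivalence = isEquivalence ; ∙-cong = cong₂ _+_ }
        ; assoc = +-assoc-ℤ
        }
      ; identity = +-identityˡ-ℤ , λ x → trans (+-comm-ℤ x 0ℤ) (+-identityˡ-ℤ x)
      }
    ; inverse = -‿inverseˡ-ℤ , λ x → trans (+-comm-ℤ x (- x)) (-‿inverseˡ-ℤ x)
    ; ⁻¹-cong = cong -_
    }

exactlyOne : ∀ {P : Set} (m : Maybe Atom) → (P ⇔ m ≡ nothing) →
             ExactlyOne4 P (m ≡ just a) (m ≡ just b) (m ≡ just c)
exactlyOne {P} m P⇔m≡nothing =
  someCase m P⇔m≡nothing , notBoth , notBoth , notBoth ,
  (λ { (refl , ()) }) , (λ { (refl , ()) }) , (λ { (refl , ()) })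
  where
  someCase : ∀ m′ → (P ⇔ m′ ≡ nothing) → P ⊎ m′ ≡ just a ⊎ m′ ≡ just b ⊎ m′ ≡ just c
  someCase nothing  P⇔ = inj₁ (Equivalence.from P⇔ refl)
  someCase (just a) _  = inj₂ (inj₁ refl)
  someCase (just b) _  = inj₂ (inj₂ (inj₁ refl))
  someCase (just c) _  = inj₂ (inj₂ (inj₂ refl))
  notBoth : ∀ {i} → ¬ (P × m ≡ just i)
  notBoth (p , m≡just) with () ← trans (sym (Equivalence.to P⇔m≡nothing p)) m≡just

module Cayley {n : ℕ} {mul : Fin n → Fin n → Fin n} {ε : Fin n} {inv : Fin n → Fin n}
              (isGroup : IsGroup _≡_ mul ε inv) (χ : Fin n → Maybe Atom) where

  infixl 7 _∙_
  _∙_ : Fin n → Fin n → Fin n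
  _∙_ = mul

  infix 8 _⁻¹
  _⁻¹ : Fin n → Fin n
  _⁻¹ = inv

  open IsGroup isGroup using (_\\_; assoc; identityʳ; inverseˡ)

  group : Group 0ℓ 0ℓ
  group = record { isGroup = isGroup }

  open GroupProperties group
    using (\\-leftDividesˡ; \\-leftDividesʳ; ⁻¹-anti-homo-\\)
  open ≡-Reasoning

  CayleyColouring : Set
  CayleyColouring =
    ((g : Fin n) → χ g ≡ nothing ⇔ g ≡ ε) ×
    ((g : Fin n) → χ (g ⁻¹) ≡ χ g) ×
    ((i : Atom) → Σ (Fin n) λ g → χ g ≡ just i) ×
    ((i j k : Atom) (g : Fin n) → χ g ≡ just i →
       (Σ (Fin n) λ h → χ h ≡ just j × χ (h \\ g) ≡ just k) ⇔ IsCycle i j k)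

  R : Atom → Fin n → Fin n → Set
  R i x y = χ (x \\ y) ≡ just i

  \\-translate : ∀ x y z → (x \\ z) \\ (x \\ y) ≡ z \\ y
  \\-translate x y z = begin
    (x \\ z) ⁻¹ ∙ (x \\ y)     ≡⟨ cong (_∙ (x \\ y)) (⁻¹-anti-homo-\\ x z) ⟩
    (z ⁻¹ ∙ x) ∙ (x \\ y)      ≡⟨ assoc (z ⁻¹) x (x \\ y) ⟩
    z ⁻¹ ∙ (x ∙ (x \\ y))      ≡⟨ cong (z ⁻¹ ∙_) (\\-leftDividesˡ x y) ⟩
    z \\ y                     ∎

  \\≡ε⇒≡ : ∀ {x y} → x \\ y ≡ ε → x ≡ y
  \\≡ε⇒≡ {x} {y} eq = begin
    x            ≡⟨ identityʳ x ⟨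
    x ∙ ε        ≡⟨ cong (x ∙_) eq ⟨
    x ∙ (x \\ y) ≡⟨ \\-leftDividesˡ x y ⟩
    y            ∎

  \\-shift : ∀ x y h → (x ∙ h) \\ y ≡ h \\ (x \\ y)
  \\-shift x y h = begin
    (x ∙ h) \\ y                ≡⟨ \\-translate x y (x ∙ h) ⟨
    (x \\ (x ∙ h)) \\ (x \\ y)   ≡⟨ cong (_\\ (x \\ y)) (\\-leftDividesʳ x h) ⟩
    h \\ (x \\ y)               ∎

  -- Nonemptiness, symmetry and the partition property
  -- are the first three local conditions read at x \\ y; the composition
  -- property is the fourth, transported along h = x \\ z.
  cayleyRepresentation : CayleyColouring → IsRepresentation n R
  cayleyRepresentation (identityOnly , inverseInvariant , everyAtomUsed , localCycles) =
    nonempty , symmetric , partition , composition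
    where
    nonempty : (i : Atom) → Σ (Fin n) λ x → Σ (Fin n) λ y → R i x y
    nonempty i with everyAtomUsed i
    ... | g , χg≡i = ε , ε ∙ g , trans (cong χ (\\-leftDividesʳ ε g)) χg≡i

    symmetric : (i : Atom) (x y : Fin n) → R i x y → R i y x
    symmetric i x y r = begin
      χ (y \\ x)        ≡⟨ cong χ (⁻¹-anti-homo-\\ x y) ⟨
      χ ((x \\ y) ⁻¹)   ≡⟨ inverseInvariant (x \\ y) ⟩
      χ (x \\ y)        ≡⟨ r ⟩
      just i            ∎

    partition : (x y : Fin n) → ExactlyOne4 (x ≡ y) (R a x y) (R b x y) (R c x y)
    partition x y = exactlyOne (χ (x \\ y)) (mk⇔ diagonal offDiagonal)
      where
      diagonal : x ≡ y → χ (x \\ y) ≡ nothing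
      diagonal refl = Equivalence.from (identityOnly (x \\ x)) (inverseˡ x)
      offDiagonal : χ (x \\ y) ≡ nothing → x ≡ y
      offDiagonal uncoloured = \\≡ε⇒≡ (Equivalence.to (identityOnly (x \\ y)) uncoloured)

    composition : (i j k : Atom) (x y : Fin n) → R i x y →
                  (Σ (Fin n) λ z → R j x z × R k z y) ⇔ IsCycle i j k
    composition i j k x y r =
      mk⇔ (λ p → Equivalence.to local (toDifferences p))
          (λ cyc → fromDifferences (Equivalence.from local cyc))
      where
      local = localCycles i j k (x \\ y) r
      toDifferences : (Σ (Fin n) λ z → R j x z × R k z y) →
                      Σ (Fin n) λ h → χ h ≡ just j × χ (h \\ (x \\ y)) ≡ just k
      toDifferences (z , xz , zy) = x \\ z , xz , trans (cong χ (\\-translate x y z)) zy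
      fromDifferences : (Σ (Fin n) λ h → χ h ≡ just j × χ (h \\ (x \\ y)) ≡ just k) →
                        Σ (Fin n) λ z → R j x z × R k z y
      fromDifferences (h , χh , χhg) =
        x ∙ h , trans (cong χ (\\-leftDividesʳ x h)) χh , trans (cong χ (\\-shift x y h)) χhg

  -- The local conditions only quantify over atoms and the finite group, so
  -- they can be checked mechanically.
  cayleyColouring? : Dec CayleyColouring
  cayleyColouring? =
    (all? λ g → (χ g ≟ᴹ nothing) ⇔-dec (g ≟ ε)) ×-dec
    (all? λ g → χ (g ⁻¹) ≟ᴹ χ g) ×-dec
    allAtoms? (λ i → any? λ g → χ g ≟ᴹ just i) ×-dec
    allAtoms? (λ i → allAtoms? λ j → allAtoms? λ k → all? λ g →
      (χ g ≟ᴹ just i) →-dec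
      ((any? λ h → (χ h ≟ᴹ just j) ×-dec (χ (h \\ g) ≟ᴹ just k)) ⇔-dec isCycle? i j k))
    where
    _≟ᴹ_ : DecidableEquality (Maybe Atom)
    _≟ᴹ_ = Maybe.≡-dec _≟ᴬ_

-- The colouring of ℤ₃₆ realising 52_65: the residue 0 is uncoloured, and
-- the residues 1, …, 35 receive the colours listed below (a palindrome,
-- as invariance under g ↦ −g requires).
colours : Vec Atom 35
colours =
  a ∷ a ∷ a ∷ b ∷ c ∷ c ∷ c ∷
  b ∷ c ∷ a ∷ a ∷ b ∷ a ∷ a ∷
  a ∷ b ∷ c ∷ a ∷ c ∷ b ∷ a ∷
  a ∷ a ∷ b ∷ a ∷ a ∷ c ∷ b ∷
  c ∷ c ∷ c ∷ b ∷ a ∷ a ∷ a ∷ []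

χ₃₆ : Fin 36 → Maybe Atom
χ₃₆ zero    = nothing
χ₃₆ (suc g) = just (lookup colours g)

module ℤ₃₆ = Cyclic 36
module Representation₃₆ = Cayley ℤ₃₆.isGroup χ₃₆

-- The decision procedure accepts χ₃₆, so the Cayley relations on ℤ₃₆
-- represent 52_65.
mainTheorem1 : FinitelyRepresentable
mainTheorem1 =
  36 , R , cayleyRepresentation (toWitness {a? = cayleyColouring?} tt)
  where open Representation₃₆
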